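{- Let $G$ be a simple graph and $n\in\mathbb{Z}^+$. If the chromatic number $\chi(G)$ is finite, then $\chi_{n,0}(G)=\chi(G)$.
   Context: Graphs are simple, possibly infinite, $G=(V,E)$. A labeling (coloring) is a map $\ell:V\to\mathbb{Z}$; its order $|\ell|$ is the size of its image. It is proper if adjacent vertices get different labels; $\chi(G)$ is the minimum order of a proper labeling. For $v\in V$, $N[v]$ is the closed neighborhood ($v$ together with its neighbors). For $k\in\mathbb{Z}$, $n\in\mathbb{Z}^+$, a closed coloring with remainder $k\bmod n$ is a labeling $\ell$ with $\sum_{w\in N[v]}\ell(w)\equiv k\pmod n$ for every $v\in V$. If no proper closed coloring with remainder $k\bmod n$ exists, $\chi_{n,k}(G)$ does not exist; if proper ones of finite order exist, $\chi_{n,k}(G)$ is the minimum order of such a coloring; if they exist only of infinite order, $\chi_{n,k}(G)=\infty$. -}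

module Defs where

open import Level using (Level; suc)
open import Data.Nat using (ℕ; _≤_; NonZero)
open import Data.Integer using (ℤ; +_; _+_; _-_)
open import Data.Integer.Divisibility using (_∣_)
open import Data.List using (List; length; map; foldr)
open import Data.List.Membership.Propositional using (_∈_)
open import Data.List.Relation.Unary.Unique.Propositional using (Unique)
open import Data.Product using (Σ; ∃; _×_)
open import Relation.Binary.PropositionalEquality using (_≡_)
open import Relation.Nullary using (¬_)

-- A simple graph, possibly infinite, but locally finite: every vertex has a
-- finite neighbourhood, listed without repetition by `nbrs`
-- (needed so that closed-neighbourhood sums are defined).
record Graph : Set₁ where
  field
    V       : Set
    Adj     : V → V → Set
    irrefl  : ∀ v → ¬ Adj v v
    sym     : ∀ {u v} → Adj u v → Adj v u
    nbrs    : V → List V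
    nbrs-unique : ∀ v → Unique (nbrs v)
    nbrs-sound  : ∀ {u v} → u ∈ nbrs v → Adj v u
    nbrs-complete : ∀ {u v} → Adj v u → u ∈ nbrs v

open Graph public

Labeling : Graph → Set
Labeling G = V G → ℤ

HasOrder : (G : Graph) → Labeling G → ℕ → Set
HasOrder G ℓ m =
  Σ (List ℤ) λ xs → length xs ≡ m × Unique xs
    × (∀ v → ℓ v ∈ xs) × (∀ x → x ∈ xs → ∃ λ v → ℓ v ≡ x)

Proper : (G : Graph) → Labeling G → Set
Proper G ℓ = ∀ {u v} → Adj G u v → ¬ ℓ u ≡ ℓ v

closedSum : (G : Graph) → Labeling G → V G → ℤ
closedSum G ℓ v = ℓ v + foldr _+_ (+ 0) (map ℓ (nbrs G v))

ClosedColoring : (G : Graph) → ℕ → ℤ → Labeling G → Set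
ClosedColoring G n k ℓ = ∀ v → (+ n) ∣ (closedSum G ℓ v - k)

ChromaticNumberIs : Graph → ℕ → Set
ChromaticNumberIs G m =
  (Σ (Labeling G) λ ℓ → Proper G ℓ × HasOrder G ℓ m)
  × (∀ ℓ k → Proper G ℓ → HasOrder G ℓ k → m ≤ k)

ClosedChromaticNumberIs : Graph → ℕ → ℤ → ℕ → Set
ClosedChromaticNumberIs G n k m =
  (Σ (Labeling G) λ ℓ → Proper G ℓ × ClosedColoring G n k ℓ × HasOrder G ℓ m)
  × (∀ ℓ j → Proper G ℓ → ClosedColoring G n k ℓ → HasOrder G ℓ j → m ≤ j)

module Submission where

open import Defs hiding (sym)
open import Data.Nat using (ℕ; NonZero)
open import Data.Integer using (ℤ; +_; _+_; _*_)
open import Data.Integer.Properties using (*-cancelˡ-≡; +-identityʳ)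
open import Data.Integer.Divisibility.Signed as Signed using (∣⇒∣ᵤ; ∣m∣n⇒∣m+n; ∣m⇒∣m*n)
open import Data.List using ([]; _∷_; map; foldr)
open import Data.List.Properties using (length-map)
open import Data.List.Membership.Propositional using (_∈_)
open import Data.List.Membership.Propositional.Properties using (∈-map⁺; ∈-map⁻)
import Data.List.Relation.Unary.Unique.Propositional.Properties as Unique
open import Data.Product using (_,_; ∃)
open import Function using (_∘_)
open import Function.Definitions using (Injective)
open import Relation.Binary.PropositionalEquality using (_≡_; refl; sym; trans)

-- Multiplying an optimal proper coloring by n keeps it proper and of the same
-- order, and makes every label, hence every closed-neighbourhood sum, divisible
-- by n.  Conversely every proper closed coloring is in particular proper, so it
-- cannot use fewer than χ(G) labels.

∣-sum-map : ∀ {A : Set} {d} {f : A → ℤ} → (∀ x → d Signed.∣ f x) →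
  ∀ xs → d Signed.∣ foldr _+_ (+ 0) (map f xs)
∣-sum-map d∣f []       = Signed.divides (+ 0) refl
∣-sum-map d∣f (x ∷ xs) = ∣m∣n⇒∣m+n (d∣f x) (∣-sum-map d∣f xs)

module _ (G : Graph) {f : ℤ → ℤ} (f-injective : Injective _≡_ _≡_ f) where

  Proper-∘-injective : ∀ {ℓ} → Proper G ℓ → Proper G (f ∘ ℓ)
  Proper-∘-injective ℓ-proper u~v = ℓ-proper u~v ∘ f-injective

  HasOrder-∘-injective : ∀ {ℓ m} → HasOrder G ℓ m → HasOrder G (f ∘ ℓ) m
  HasOrder-∘-injective {ℓ} (xs , |xs|≡m , xs-unique , ℓ∈xs , xs⊆img) =
    map f xs , trans (length-map f xs) |xs|≡m , Unique.map⁺ f-injective xs-unique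
    , (∈-map⁺ f ∘ ℓ∈xs) , f[xs]⊆img
    where
    f[xs]⊆img : ∀ y → y ∈ map f xs → ∃ λ v → f (ℓ v) ≡ y
    f[xs]⊆img y y∈f[xs] with ∈-map⁻ f y∈f[xs]
    ... | x , x∈xs , refl with xs⊆img x x∈xs
    ... | v , refl = v , refl

scale-closedColoring : (G : Graph) (n : ℕ) (ℓ : Labeling G) →
  ClosedColoring G n (+ 0) ((+ n *_) ∘ ℓ)
scale-closedColoring G n ℓ v =
  ∣⇒∣ᵤ (Signed.∣-trans n∣closedSum (Signed.∣-reflexive (sym (+-identityʳ _))))
  where
  n∣scaled : ∀ w → + n Signed.∣ + n * ℓ w
  n∣scaled w = ∣m⇒∣m*n (ℓ w) Signed.∣-refl

  n∣closedSum : + n Signed.∣ closedSum G ((+ n *_) ∘ ℓ) v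
  n∣closedSum = ∣m∣n⇒∣m+n (n∣scaled v) (∣-sum-map n∣scaled (nbrs G v))

theorem3p1 : (G : Graph) (n : ℕ) → .{{_ : NonZero n}} → (m : ℕ) →
    ChromaticNumberIs G m → ClosedChromaticNumberIs G n (+ 0) m
theorem3p1 G n m ((ℓ , ℓ-proper , ℓ-order) , χ-minimal) =
  ( (+ n *_) ∘ ℓ
  , Proper-∘-injective G scale-injective ℓ-proper
  , scale-closedColoring G n ℓ
  , HasOrder-∘-injective G scale-injective ℓ-order )
  , λ ℓ′ j ℓ′-proper _ ℓ′-order → χ-minimal ℓ′ j ℓ′-proper ℓ′-order
  where
  scale-injective : Injective _≡_ _≡_ (+ n *_)
  scale-injective = *-cancelˡ-≡ (+ n) _ _
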